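{- Let $I$ and $J$ be independent sets in a connected claw-free graph $G$ with $|I|=|J|$. If $G[I\Delta J]$ contains no cycles, then there is a TS-sequence from $I$ to $J$ of length at most $2\cdot|I\setminus J|\cdot\mathrm{diam}(G)$.
   Context: Graphs are finite and simple; claw-free means no induced $K_{1,3}$. $\mathrm{diam}(G)=\max_{u,v}d_G(u,v)$. A TS-sequence of length $m$ is a sequence $I_0,\ldots,I_m$ of independent sets such that each $I_{i+1}$ arises from $I_i$ by a move $u\to v$: $uv\in E(G)$, $I_i\setminus I_{i+1}=\{u\}$, $I_{i+1}\setminus I_i=\{v\}$. -}

module Defs where

open import Data.Nat using (ℕ; zero; suc; _≤_; _<_; _*_)
open import Data.Bool using (Bool; true; false)
open import Data.Fin using (Fin)
open import Data.Fin.Subset using (Subset; _∈_; _∉_; _─_; _∪_; ∣_∣)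
open import Data.List using (List; []; _∷_; length)
open import Data.List.Relation.Unary.All using (All)
open import Data.List.Relation.Unary.Unique.Propositional using (Unique)
open import Data.Product using (Σ; ∃; ∃-syntax; _×_; _,_)
open import Data.Empty using (⊥)
open import Data.Unit using (⊤)
open import Relation.Nullary using (¬_)
open import Relation.Binary.PropositionalEquality using (_≡_; _≢_)
open import Function.Bundles using (_⇔_)

record Graph (n : ℕ) : Set where
  field
    adj   : Fin n → Fin n → Bool
    sym   : ∀ u v → adj u v ≡ adj v u
    irrefl : ∀ v → adj v v ≡ false

module _ {n : ℕ} (G : Graph n) where
  open Graph G

  Adj : Fin n → Fin n → Set
  Adj u v = adj u v ≡ true

  data Walk : Fin n → Fin n → ℕ → Set where
    here : ∀ v → Walk v v zero
    step : ∀ {u w v k} → Adj u w → Walk w v k → Walk u v (suc k)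

  Dist : Fin n → Fin n → ℕ → Set
  Dist u v d = Walk u v d × (∀ k → k < d → ¬ Walk u v k)

  Connected : Set
  Connected = ∀ u v → ∃[ k ] Walk u v k

  IsDiameter : ℕ → Set
  IsDiameter D = (∀ u v d → Dist u v d → d ≤ D)
               × (∃[ u ] ∃[ v ] Dist u v D)

  ClawFree : Set
  ClawFree = ¬ (Σ (Fin n) λ c → Σ (Fin n) λ a → Σ (Fin n) λ b → Σ (Fin n) λ d →
                 Adj c a × Adj c b × Adj c d ×
                 a ≢ b × a ≢ d × b ≢ d ×
                 ¬ Adj a b × ¬ Adj a d × ¬ Adj b d)

  Independent : Subset n → Set
  Independent I = ∀ u v → u ∈ I → v ∈ I → ¬ Adj u v

  Path : List (Fin n) → Set
  Path [] = ⊤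
  Path (x ∷ []) = ⊤
  Path (x ∷ y ∷ xs) = Adj x y × Path (y ∷ xs)

  Closes : Fin n → List (Fin n) → Set
  Closes x [] = ⊥
  Closes x (y ∷ []) = Adj y x
  Closes x (y ∷ z ∷ zs) = Closes x (z ∷ zs)

  HasCycleIn : Subset n → Set
  HasCycleIn S = Σ (Fin n) λ x → Σ (List (Fin n)) λ xs →
                   2 ≤ length xs × Unique (x ∷ xs) × All (_∈ S) (x ∷ xs) ×
                   Path (x ∷ xs) × Closes x (x ∷ xs)

  Move : Subset n → Subset n → Set
  Move I I' = Σ (Fin n) λ u → Σ (Fin n) λ v → Adj u v ×
                (∀ x → (x ∈ I × x ∉ I') ⇔ (x ≡ u)) ×
                (∀ x → (x ∈ I' × x ∉ I) ⇔ (x ≡ v))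

  data TSSeq : Subset n → Subset n → ℕ → Set where
    done : ∀ {I} → Independent I → TSSeq I I zero
    move : ∀ {I I' J m} → Independent I → Move I I' → TSSeq I' J m →
           TSSeq I J (suc m)

SymDiff : ∀ {n} → Subset n → Subset n → Subset n
SymDiff I J = (I ─ J) ∪ (J ─ I)

-- Induction on |I ∖ J|: each round moves one token from some u ∈ I ∖ J onto some v ∈ J ∖ I with at
-- most 2·diam(G) moves; then I ∖ J shrinks and G[I Δ J] can only lose vertices.
-- If some v ∈ J ∖ I has exactly one neighbour u in I, then u ∉ J and u → v is a single move.
-- If v has no neighbour in I, the token of any u ∈ I ∖ J travels to v along a shortest path
-- v q₁ q₂ … u at two moves per edge: if q₁ has no neighbour in I, the token first reaches q₁
-- recursively and then steps to v; otherwise claw-freeness at q₁ makes its I-neighbour y unique and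
-- forces y = q₂ or y ~ q₂, so y hops to v through q₁ and the token of u recursively replaces y.
-- Otherwise every vertex of J ∖ I has at least two neighbours in I ∖ J, while (claw-freeness, J
-- independent) every vertex of I ∖ J has at most two in J ∖ I. As |I ∖ J| = |J ∖ I|, double counting
-- these edges gives every vertex of I ∖ J exactly two, so G[I Δ J] has minimum degree two and
-- contains a cycle.

module Submission where

open import Data.Bool using (Bool; true; false)
import Data.Bool.Properties as Bool
open import Data.Fin using (Fin; zero; suc; _≟_)
open import Data.Fin.Properties using (pigeonhole; any?) renaming (<⇒≢ to <⇒≢ᶠ)
open import Data.Fin.Subset using (Subset; _∈_; _∉_; _⊆_; _⊂_; _─_; ∣_∣; inside; outside; Nonempty; Empty; ⊥)
open import Data.Fin.Subset.Properties
  using (_∈?_; nonempty?; Empty-unique; ∣⊥∣≡0; p─q⊆p; x∈p∧x∉q⇒x∈p─q; x∈p∪q⁻; x∈p∪q⁺; p⊂q⇒∣p∣<∣q∣; ⊆-antisym)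
open import Data.List as List using (List; []; _∷_; length)
open import Data.List.Membership.Propositional using () renaming (_∈_ to _∈ₗ_; _∉_ to _∉ₗ_)
open import Data.List.Membership.Propositional.Properties using (∈-lookup)
open import Data.List.Relation.Unary.All as All using (All; []; _∷_)
open import Data.List.Relation.Unary.All.Properties using (¬Any⇒All¬)
open import Data.List.Relation.Unary.AllPairs using ([]; _∷_)
open import Data.List.Relation.Unary.Any as Any using (here; there)
open import Data.List.Relation.Unary.Unique.Propositional using (Unique)
open import Data.Nat using (ℕ; zero; suc; _+_; _*_; _≤_; _<_; z≤n; s≤s; _≤?_)
open import Data.Nat.Induction using (<-rec)
open import Data.Nat.Properties hiding (_≟_)
open import Algebra.Properties.CommutativeMonoid.Sum +-0-commutativeMonoid using (sum-syntax; sum-cong-≗; ∑-comm)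
open import Algebra.Properties.Semiring.Sum +-*-semiring using (*-distribˡ-sum)
open import Data.Product using (∃-syntax; _×_; _,_; proj₁; proj₂)
open import Data.Sum using (_⊎_; inj₁; inj₂)
open import Data.Vec using ([]; _∷_; here; there; tabulate; _[_]≔_; lookup)
open import Data.Vec.Properties
  using (lookup∘tabulate; []≔-lookup; []≔-minimal; []≔-idempotent; []≔-commutes; []≔-updates;
         []=⇒lookup; lookup⇒[]=; lookup∘update; lookup∘update′)
open import Function using (_∘_)
open import Function.Bundles using (mk⇔)
open import Relation.Binary.PropositionalEquality using (_≡_; _≢_; refl; sym; trans; cong; subst; module ≡-Reasoning)
open import Relation.Nullary using (¬_; Dec; yes; no; does; contradiction)
open import Relation.Nullary.Decidable using (dec-true; _×-dec_)
open import Relation.Unary using (Decidable)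

open import Defs

private variable
  n : ℕ

-- Subsets and their cardinality

module _ {p : Subset n} {x : Fin n} where

  x∈p⇒lookup≡inside : x ∈ p → lookup p x ≡ inside
  x∈p⇒lookup≡inside = []=⇒lookup

  x∉p⇒lookup≡outside : x ∉ p → lookup p x ≡ outside
  x∉p⇒lookup≡outside x∉p = Bool.¬-not (x∉p ∘ lookup⇒[]= x p)

  x∈p⇒p[x]≔inside≡p : x ∈ p → p [ x ]≔ inside ≡ p
  x∈p⇒p[x]≔inside≡p x∈p = trans (cong (p [ x ]≔_) (sym (x∈p⇒lookup≡inside x∈p))) ([]≔-lookup p x)

  x∉p⇒p[x]≔outside≡p : x ∉ p → p [ x ]≔ outside ≡ p
  x∉p⇒p[x]≔outside≡p x∉p = trans (cong (p [ x ]≔_) (sym (x∉p⇒lookup≡outside x∉p))) ([]≔-lookup p x)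

x∈p∧y∉p⇒x≢y : ∀ {p : Subset n} {x y} → x ∈ p → y ∉ p → x ≢ y
x∈p∧y∉p⇒x≢y x∈p y∉p refl = y∉p x∈p

∈-[]≔outside⁻ : ∀ {p : Subset n} {x y} → y ∈ p [ x ]≔ outside → y ∈ p × y ≢ x
∈-[]≔outside⁻ {p = p} {x} {y} y∈ with y ≟ x
... | yes refl = contradiction (trans (sym (x∈p⇒lookup≡inside y∈)) (lookup∘update y p outside)) λ ()
... | no y≢x = lookup⇒[]= y p (trans (sym (lookup∘update′ y≢x p outside)) (x∈p⇒lookup≡inside y∈)) , y≢x

∣p[x]≔inside∣≡1+∣p[x]≔outside∣ : ∀ (p : Subset n) x → ∣ p [ x ]≔ inside ∣ ≡ suc ∣ p [ x ]≔ outside ∣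
∣p[x]≔inside∣≡1+∣p[x]≔outside∣ (s ∷ p) zero = refl
∣p[x]≔inside∣≡1+∣p[x]≔outside∣ (inside ∷ p) (suc x) = cong suc (∣p[x]≔inside∣≡1+∣p[x]≔outside∣ p x)
∣p[x]≔inside∣≡1+∣p[x]≔outside∣ (outside ∷ p) (suc x) = ∣p[x]≔inside∣≡1+∣p[x]≔outside∣ p x

x∈p⇒∣p∣≡1+∣p[x]≔outside∣ : ∀ {p : Subset n} {x} → x ∈ p → ∣ p ∣ ≡ suc ∣ p [ x ]≔ outside ∣
x∈p⇒∣p∣≡1+∣p[x]≔outside∣ {p = p} {x} x∈p =
  trans (cong ∣_∣ (sym (x∈p⇒p[x]≔inside≡p x∈p))) (∣p[x]≔inside∣≡1+∣p[x]≔outside∣ p x)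

∣p∣≤1+∣p[x]≔outside∣ : ∀ (p : Subset n) x → ∣ p ∣ ≤ suc ∣ p [ x ]≔ outside ∣
∣p∣≤1+∣p[x]≔outside∣ p x with x ∈? p
... | yes x∈p = ≤-reflexive (x∈p⇒∣p∣≡1+∣p[x]≔outside∣ x∈p)
... | no x∉p = ≤-trans (n≤1+n ∣ p ∣) (≤-reflexive (cong (suc ∘ ∣_∣) (sym (x∉p⇒p[x]≔outside≡p x∉p))))

Empty⇒∣p∣≡0 : ∀ {p : Subset n} → Empty p → ∣ p ∣ ≡ 0
Empty⇒∣p∣≡0 {n} empty = trans (cong ∣_∣ (Empty-unique empty)) (∣⊥∣≡0 n)

x∈p⇒0<∣p∣ : ∀ {p : Subset n} {x} → x ∈ p → 0 < ∣ p ∣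
x∈p⇒0<∣p∣ x∈p = ≤-trans (s≤s z≤n) (≤-reflexive (sym (x∈p⇒∣p∣≡1+∣p[x]≔outside∣ x∈p)))

0<∣p∣⇒nonempty : ∀ {p : Subset n} → 0 < ∣ p ∣ → Nonempty p
0<∣p∣⇒nonempty {p = p} 0<∣p∣ with nonempty? p
... | yes nonempty = nonempty
... | no empty = contradiction (Empty⇒∣p∣≡0 empty) (>⇒≢ 0<∣p∣)

x≢y⇒2≤∣p∣ : ∀ {p : Subset n} {x y} → x ∈ p → y ∈ p → x ≢ y → 2 ≤ ∣ p ∣
x≢y⇒2≤∣p∣ {p = p} {x} {y} x∈p y∈p x≢y =
  ≤-trans (s≤s (x∈p⇒0<∣p∣ ([]≔-minimal p y x (x≢y ∘ sym) y∈p))) (≤-reflexive (sym (x∈p⇒∣p∣≡1+∣p[x]≔outside∣ x∈p)))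

∣p∣≤1⇒≡ : ∀ {p : Subset n} {x y} → ∣ p ∣ ≤ 1 → x ∈ p → y ∈ p → x ≡ y
∣p∣≤1⇒≡ {x = x} {y} ∣p∣≤1 x∈p y∈p with x ≟ y
... | yes x≡y = x≡y
... | no x≢y = contradiction (≤-trans (x≢y⇒2≤∣p∣ x∈p y∈p x≢y) ∣p∣≤1) (λ { (s≤s ()) })

2≤∣p∣⇒other : ∀ {p : Subset n} → 2 ≤ ∣ p ∣ → ∀ y → ∃[ z ] (z ∈ p × z ≢ y)
2≤∣p∣⇒other {p = p} 2≤∣p∣ y with 0<∣p∣⇒nonempty (≤-pred (≤-trans 2≤∣p∣ (∣p∣≤1+∣p[x]≔outside∣ p y)))
... | z , z∈ = z , ∈-[]≔outside⁻ z∈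

3≤∣p∣⇒distinct : ∀ {p : Subset n} → 3 ≤ ∣ p ∣ →
                 ∃[ a ] ∃[ b ] ∃[ c ] (a ∈ p × b ∈ p × c ∈ p × a ≢ b × a ≢ c × b ≢ c)
3≤∣p∣⇒distinct {p = p} 3≤∣p∣ with 0<∣p∣⇒nonempty (≤-trans (s≤s z≤n) 3≤∣p∣)
... | a , a∈p with ≤-pred (≤-trans 3≤∣p∣ (≤-reflexive (x∈p⇒∣p∣≡1+∣p[x]≔outside∣ a∈p)))
... | 2≤∣p-a∣ with 0<∣p∣⇒nonempty (≤-trans (s≤s z≤n) 2≤∣p-a∣)
... | b , b∈ with 2≤∣p∣⇒other 2≤∣p-a∣ b
... | c , c∈ , c≢b with ∈-[]≔outside⁻ b∈ | ∈-[]≔outside⁻ c∈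
... | b∈p , b≢a | c∈p , c≢a = a , b , c , a∈p , b∈p , c∈p , b≢a ∘ sym , c≢a ∘ sym , c≢b ∘ sym

x∈p─q⇒x∉q : ∀ {p q : Subset n} {x} → x ∈ p ─ q → x ∉ q
x∈p─q⇒x∉q {p = _ ∷ _} {outside ∷ _} here ()
x∈p─q⇒x∉q {p = _ ∷ _} {_ ∷ _} (there x∈p─q) (there x∈q) = x∈p─q⇒x∉q x∈p─q x∈q

x∈p─q⁻ : ∀ (p q : Subset n) {x} → x ∈ p ─ q → x ∈ p × x ∉ q
x∈p─q⁻ p q x∈p─q = p─q⊆p p q x∈p─q , x∈p─q⇒x∉q x∈p─q

Empty[p─q]⇒p⊆q : ∀ {p q : Subset n} → Empty (p ─ q) → p ⊆ q
Empty[p─q]⇒p⊆q {q = q} empty {x} x∈p with x ∈? q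
... | yes x∈q = x∈q
... | no x∉q = contradiction (x , x∈p∧x∉q⇒x∈p─q x∈p x∉q) empty

∣p∣+∣q─p∣≡∣q∣+∣p─q∣ : ∀ (p q : Subset n) → ∣ p ∣ + ∣ q ─ p ∣ ≡ ∣ q ∣ + ∣ p ─ q ∣
∣p∣+∣q─p∣≡∣q∣+∣p─q∣ [] [] = refl
∣p∣+∣q─p∣≡∣q∣+∣p─q∣ (inside ∷ p) (inside ∷ q) = cong suc (∣p∣+∣q─p∣≡∣q∣+∣p─q∣ p q)
∣p∣+∣q─p∣≡∣q∣+∣p─q∣ (inside ∷ p) (outside ∷ q) =
  trans (cong suc (∣p∣+∣q─p∣≡∣q∣+∣p─q∣ p q)) (sym (+-suc ∣ q ∣ ∣ p ─ q ∣))
∣p∣+∣q─p∣≡∣q∣+∣p─q∣ (outside ∷ p) (inside ∷ q) =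
  trans (+-suc ∣ p ∣ ∣ q ─ p ∣) (cong suc (∣p∣+∣q─p∣≡∣q∣+∣p─q∣ p q))
∣p∣+∣q─p∣≡∣q∣+∣p─q∣ (outside ∷ p) (outside ∷ q) = ∣p∣+∣q─p∣≡∣q∣+∣p─q∣ p q

∣p∣≡∣q∣⇒∣p─q∣≡∣q─p∣ : ∀ (p q : Subset n) → ∣ p ∣ ≡ ∣ q ∣ → ∣ p ─ q ∣ ≡ ∣ q ─ p ∣
∣p∣≡∣q∣⇒∣p─q∣≡∣q─p∣ p q ∣p∣≡∣q∣ =
  sym (+-cancelˡ-≡ ∣ p ∣ _ _ (trans (∣p∣+∣q─p∣≡∣q∣+∣p─q∣ p q) (cong (_+ ∣ p ─ q ∣) (sym ∣p∣≡∣q∣))))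

Empty[p─q]⇒p≡q : ∀ {p q : Subset n} → Empty (p ─ q) → ∣ p ∣ ≡ ∣ q ∣ → p ≡ q
Empty[p─q]⇒p≡q {p = p} {q} p─q=∅ ∣p∣≡∣q∣ = ⊆-antisym (Empty[p─q]⇒p⊆q p─q=∅) (Empty[p─q]⇒p⊆q q─p=∅)
  where
  q─p=∅ : Empty (q ─ p)
  q─p=∅ (x , x∈q─p) =
    >⇒≢ (x∈p⇒0<∣p∣ x∈q─p) (trans (sym (∣p∣≡∣q∣⇒∣p─q∣≡∣q─p∣ p q ∣p∣≡∣q∣)) (Empty⇒∣p∣≡0 p─q=∅))

-- Sliding a token

slide : Subset n → Fin n → Fin n → Subset n
slide K a b = K [ a ]≔ outside [ b ]≔ inside

module _ {K : Subset n} {a b : Fin n} where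

  b∈slide : b ∈ slide K a b
  b∈slide = []≔-updates (K [ a ]≔ outside) b

  ∈-slide⁺ : ∀ {x} → x ∈ K → x ≢ a → x ∈ slide K a b
  ∈-slide⁺ {x} x∈K x≢a with x ≟ b
  ... | yes refl = b∈slide
  ... | no x≢b = []≔-minimal (K [ a ]≔ outside) x b x≢b ([]≔-minimal K x a x≢a x∈K)

  ∈-slide⁻ : ∀ {x} → x ∈ slide K a b → x ≡ b ⊎ (x ∈ K × x ≢ a)
  ∈-slide⁻ {x} x∈ with x ≟ b
  ... | yes x≡b = inj₁ x≡b
  ... | no x≢b = inj₂ (∈-[]≔outside⁻ (lookup⇒[]= x _
                   (trans (sym (lookup∘update′ x≢b (K [ a ]≔ outside) inside)) (x∈p⇒lookup≡inside x∈))))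

  a∉slide : a ≢ b → a ∉ slide K a b
  a∉slide a≢b a∈ with ∈-slide⁻ a∈
  ... | inj₁ a≡b = a≢b a≡b
  ... | inj₂ (_ , a≢a) = a≢a refl

  ∣slide∣≡∣K∣ : a ∈ K → b ∉ K → ∣ slide K a b ∣ ≡ ∣ K ∣
  ∣slide∣≡∣K∣ a∈K b∉K = begin
      ∣ K [ a ]≔ outside [ b ]≔ inside ∣
    ≡⟨ ∣p[x]≔inside∣≡1+∣p[x]≔outside∣ (K [ a ]≔ outside) b ⟩
      suc ∣ K [ a ]≔ outside [ b ]≔ outside ∣
    ≡⟨ cong (suc ∘ ∣_∣) (x∉p⇒p[x]≔outside≡p (b∉K ∘ proj₁ ∘ ∈-[]≔outside⁻)) ⟩
      suc ∣ K [ a ]≔ outside ∣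
    ≡⟨ x∈p⇒∣p∣≡1+∣p[x]≔outside∣ a∈K ⟨
      ∣ K ∣
    ∎
    where open ≡-Reasoning

slide-trans : ∀ {I : Subset n} {a q h} → q ∉ I → slide (slide I a q) q h ≡ slide I a h
slide-trans {I = I} {a} {q} {h} q∉I = begin
    I [ a ]≔ outside [ q ]≔ inside [ q ]≔ outside [ h ]≔ inside
  ≡⟨ cong (_[ h ]≔ inside) ([]≔-idempotent (I [ a ]≔ outside) q) ⟩
    I [ a ]≔ outside [ q ]≔ outside [ h ]≔ inside
  ≡⟨ cong (_[ h ]≔ inside) (x∉p⇒p[x]≔outside≡p (q∉I ∘ proj₁ ∘ ∈-[]≔outside⁻)) ⟩
    I [ a ]≔ outside [ h ]≔ inside
  ∎
  where open ≡-Reasoning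

slide-relay : ∀ {I : Subset n} {y u h} → y ∈ I → u ≢ y → h ≢ u → h ≢ y → slide (slide I y h) u y ≡ slide I u h
slide-relay {I = I} {y} {u} {h} y∈I u≢y h≢u h≢y = begin
    I [ y ]≔ outside [ h ]≔ inside [ u ]≔ outside [ y ]≔ inside
  ≡⟨ cong (_[ y ]≔ inside) ([]≔-commutes (I [ y ]≔ outside) h u h≢u) ⟩
    I [ y ]≔ outside [ u ]≔ outside [ h ]≔ inside [ y ]≔ inside
  ≡⟨ []≔-commutes (I [ y ]≔ outside [ u ]≔ outside) h y h≢y ⟩
    I [ y ]≔ outside [ u ]≔ outside [ y ]≔ inside [ h ]≔ inside
  ≡⟨ cong (_[ h ]≔ inside) ([]≔-commutes (I [ y ]≔ outside) u y u≢y) ⟩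
    I [ y ]≔ outside [ y ]≔ inside [ u ]≔ outside [ h ]≔ inside
  ≡⟨ cong (λ K → K [ u ]≔ outside [ h ]≔ inside) ([]≔-idempotent I y) ⟩
    I [ y ]≔ inside [ u ]≔ outside [ h ]≔ inside
  ≡⟨ cong (λ K → K [ u ]≔ outside [ h ]≔ inside) (x∈p⇒p[x]≔inside≡p y∈I) ⟩
    I [ u ]≔ outside [ h ]≔ inside
  ∎
  where open ≡-Reasoning

module _ {I J : Subset n} {u v} (u∈I : u ∈ I) (u∉J : u ∉ J) (v∈J : v ∈ J) (v∉I : v ∉ I) where

  slide-─⊆ : slide I u v ─ J ⊆ I ─ J
  slide-─⊆ x∈ with x∈p─q⁻ (slide I u v) J x∈
  ... | x∈I′ , x∉J with ∈-slide⁻ x∈I′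
  ...   | inj₁ refl = contradiction v∈J x∉J
  ...   | inj₂ (x∈I , _) = x∈p∧x∉q⇒x∈p─q x∈I x∉J

  slide-─⊂ : slide I u v ─ J ⊂ I ─ J
  slide-─⊂ = slide-─⊆ , u , x∈p∧x∉q⇒x∈p─q u∈I u∉J ,
             a∉slide (x∈p∧y∉p⇒x≢y u∈I v∉I) ∘ proj₁ ∘ x∈p─q⁻ (slide I u v) J

  slide-SymDiff⊆ : SymDiff (slide I u v) J ⊆ SymDiff I J
  slide-SymDiff⊆ {x} x∈ with x∈p∪q⁻ (slide I u v ─ J) (J ─ slide I u v) x∈
  ... | inj₁ x∈I′─J = x∈p∪q⁺ (inj₁ (slide-─⊆ x∈I′─J))
  ... | inj₂ x∈J─I′ with x∈p─q⁻ J (slide I u v) x∈J─I′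
  ...   | x∈J , x∉I′ = x∈p∪q⁺ (inj₂ (x∈p∧x∉q⇒x∈p─q x∈J x∉I))
    where
    x∉I : x ∉ I
    x∉I x∈I = x∉I′ (∈-slide⁺ x∈I (x∈p∧y∉p⇒x≢y x∈J u∉J))

-- Double counting

𝟙 : Bool → ℕ
𝟙 true = 1
𝟙 false = 0

∣p∣≡∑[p] : ∀ (p : Subset n) → ∣ p ∣ ≡ ∑[ i < n ] 𝟙 (lookup p i)
∣p∣≡∑[p] [] = refl
∣p∣≡∑[p] (inside ∷ p) = cong suc (∣p∣≡∑[p] p)
∣p∣≡∑[p] (outside ∷ p) = ∣p∣≡∑[p] p

∑-mono-≤ : ∀ {f g : Fin n → ℕ} → (∀ i → f i ≤ g i) → ∑[ i < n ] f i ≤ ∑[ i < n ] g i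
∑-mono-≤ {zero} f≤g = z≤n
∑-mono-≤ {suc n} f≤g = +-mono-≤ (f≤g zero) (∑-mono-≤ (f≤g ∘ suc))

∑-mono-< : ∀ {f g : Fin n → ℕ} → (∀ i → f i ≤ g i) → ∀ j → f j < g j → ∑[ i < n ] f i < ∑[ i < n ] g i
∑-mono-< f≤g zero fj<gj = +-mono-<-≤ fj<gj (∑-mono-≤ (f≤g ∘ suc))
∑-mono-< f≤g (suc j) fj<gj = +-mono-≤-< (f≤g zero) (∑-mono-< (f≤g ∘ suc) j fj<gj)

∑-squeeze : ∀ {f g : Fin n → ℕ} → (∀ i → f i ≤ g i) → ∑[ i < n ] g i ≤ ∑[ i < n ] f i → ∀ i → g i ≤ f i
∑-squeeze {f = f} {g} f≤g ∑g≤∑f i with g i ≤? f i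
... | yes gi≤fi = gi≤fi
... | no gi≰fi = contradiction ∑g≤∑f (<⇒≱ (∑-mono-< f≤g i (≰⇒> gi≰fi)))

module _ {P : Fin n → Set} (P? : Decidable P) where

  subset : Subset n
  subset = tabulate (does ∘ P?)

  ∈-subset⁺ : ∀ {i} → P i → i ∈ subset
  ∈-subset⁺ {i} Pi = lookup⇒[]= i subset (trans (lookup∘tabulate (does ∘ P?) i) (dec-true (P? i) Pi))

  ∈-subset⁻ : ∀ {i} → i ∈ subset → P i
  ∈-subset⁻ {i} i∈ with P? i | trans (sym (lookup∘tabulate (does ∘ P?) i)) (x∈p⇒lookup≡inside i∈)
  ... | yes Pi | _ = Pi

  ∣subset∣≡∑ : ∣ subset ∣ ≡ ∑[ i < n ] 𝟙 (does (P? i))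
  ∣subset∣≡∑ = trans (∣p∣≡∑[p] subset) (sum-cong-≗ (cong 𝟙 ∘ lookup∘tabulate (does ∘ P?)))

c*𝟙[x∈p]≡c : ∀ c {p : Subset n} {x} → x ∈ p → c * 𝟙 (lookup p x) ≡ c
c*𝟙[x∈p]≡c c x∈p = trans (cong ((c *_) ∘ 𝟙) (x∈p⇒lookup≡inside x∈p)) (*-identityʳ c)

c*𝟙[x∉p]≡0 : ∀ c {p : Subset n} {x} → x ∉ p → c * 𝟙 (lookup p x) ≡ 0
c*𝟙[x∉p]≡0 c x∉p = trans (cong ((c *_) ∘ 𝟙) (x∉p⇒lookup≡outside x∉p)) (*-zeroʳ c)

module _ {R : Fin n → Fin n → Set} (R? : ∀ u v → Dec (R u v)) where

  outDegree : Fin n → ℕ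
  outDegree u = ∣ subset (R? u) ∣

  inDegree : Fin n → ℕ
  inDegree v = ∣ subset (λ u → R? u v) ∣

  handshake : ∑[ u < n ] outDegree u ≡ ∑[ v < n ] inDegree v
  handshake = begin
    ∑[ u < n ] outDegree u                       ≡⟨ sum-cong-≗ (λ u → ∣subset∣≡∑ (R? u)) ⟩
    ∑[ u < n ] ∑[ v < n ] 𝟙 (does (R? u v))     ≡⟨ ∑-comm (λ u v → 𝟙 (does (R? u v))) ⟩
    ∑[ v < n ] ∑[ u < n ] 𝟙 (does (R? u v))     ≡⟨ sum-cong-≗ (λ v → sym (∣subset∣≡∑ (λ u → R? u v))) ⟩
    ∑[ v < n ] inDegree v                         ∎
    where open ≡-Reasoning

  c≤inDegree⇒c≤outDegree : ∀ (A H : Subset n) c → ∣ A ∣ ≡ ∣ H ∣ → (∀ {u v} → R u v → u ∈ A) →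
                           (∀ u → u ∈ A → outDegree u ≤ c) → (∀ v → v ∈ H → c ≤ inDegree v) →
                           ∀ u → u ∈ A → c ≤ outDegree u
  c≤inDegree⇒c≤outDegree A H c ∣A∣≡∣H∣ R⇒∈A out≤c c≤in u u∈A =
    subst (_≤ outDegree u) (c*𝟙[x∈p]≡c c u∈A) (∑-squeeze out≤c𝟙A (begin
      ∑[ i < n ] (c * 𝟙 (lookup A i))  ≡⟨ *-distribˡ-sum c (λ i → 𝟙 (lookup A i)) ⟨
      c * ∑[ i < n ] 𝟙 (lookup A i)    ≡⟨ cong (c *_) (∣p∣≡∑[p] A) ⟨
      c * ∣ A ∣                         ≡⟨ cong (c *_) ∣A∣≡∣H∣ ⟩
      c * ∣ H ∣                         ≡⟨ cong (c *_) (∣p∣≡∑[p] H) ⟩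
      c * ∑[ i < n ] 𝟙 (lookup H i)    ≡⟨ *-distribˡ-sum c (λ i → 𝟙 (lookup H i)) ⟩
      ∑[ i < n ] (c * 𝟙 (lookup H i))  ≤⟨ ∑-mono-≤ c𝟙H≤in ⟩
      ∑[ i < n ] inDegree i             ≡⟨ handshake ⟨
      ∑[ i < n ] outDegree i            ∎) u)
    where
    open ≤-Reasoning
    out≤c𝟙A : ∀ i → outDegree i ≤ c * 𝟙 (lookup A i)
    out≤c𝟙A i with i ∈? A
    ... | yes i∈A = subst (outDegree i ≤_) (sym (c*𝟙[x∈p]≡c c i∈A)) (out≤c i i∈A)
    ... | no i∉A = subst (_≤ c * 𝟙 (lookup A i)) (sym (Empty⇒∣p∣≡0 no-successor)) z≤n
      where
      no-successor : Empty (subset (R? i))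
      no-successor (_ , v∈) = i∉A (R⇒∈A (∈-subset⁻ (R? i) v∈))
    c𝟙H≤in : ∀ i → c * 𝟙 (lookup H i) ≤ inDegree i
    c𝟙H≤in i with i ∈? H
    ... | yes i∈H = subst (_≤ inDegree i) (sym (c*𝟙[x∈p]≡c c i∈H)) (c≤in i i∈H)
    ... | no i∉H = subst (_≤ inDegree i) (sym (c*𝟙[x∉p]≡0 c i∉H)) z≤n

-- Paths and cycles

module _ {a} {A : Set a} where

  lookup-injective : ∀ {xs : List A} → Unique xs → ∀ i j → List.lookup xs i ≡ List.lookup xs j → i ≡ j
  lookup-injective (_ ∷ _) zero zero _ = refl
  lookup-injective (x∉xs ∷ _) zero (suc j) eq = contradiction eq (All.lookup x∉xs (∈-lookup j))
  lookup-injective (x∉xs ∷ _) (suc i) zero eq = contradiction (sym eq) (All.lookup x∉xs (∈-lookup i))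
  lookup-injective (_ ∷ xs!) (suc i) (suc j) eq = cong suc (lookup-injective xs! i j eq)

  prefixTo : ∀ {z} (ys : List A) → z ∈ₗ ys → List A
  prefixTo (y ∷ ys) (here _) = y ∷ []
  prefixTo (y ∷ ys) (there z∈ys) = y ∷ prefixTo ys z∈ys

  All-prefixTo : ∀ {p} {P : A → Set p} {z} (ys : List A) (z∈ys : z ∈ₗ ys) → All P ys → All P (prefixTo ys z∈ys)
  All-prefixTo (y ∷ ys) (here _) (py ∷ _) = py ∷ []
  All-prefixTo (y ∷ ys) (there z∈ys) (py ∷ pys) = py ∷ All-prefixTo ys z∈ys pys

  Unique-prefixTo : ∀ {z} (ys : List A) (z∈ys : z ∈ₗ ys) → Unique ys → Unique (prefixTo ys z∈ys)
  Unique-prefixTo (y ∷ ys) (here _) (_ ∷ _) = [] ∷ []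
  Unique-prefixTo (y ∷ ys) (there z∈ys) (y∉ys ∷ ys!) = All-prefixTo ys z∈ys y∉ys ∷ Unique-prefixTo ys z∈ys ys!

  1≤length-prefixTo : ∀ {z} (ys : List A) (z∈ys : z ∈ₗ ys) → 1 ≤ length (prefixTo ys z∈ys)
  1≤length-prefixTo (y ∷ ys) (here _) = s≤s z≤n
  1≤length-prefixTo (y ∷ ys) (there _) = s≤s z≤n

Unique⇒length≤ : ∀ {xs : List (Fin n)} → Unique xs → length xs ≤ n
Unique⇒length≤ {n} {xs} xs! with length xs ≤? n
... | yes ≤n = ≤n
... | no ≰n with pigeonhole (≰⇒> ≰n) (List.lookup xs)
... | i , j , i<j , eq = contradiction (lookup-injective xs! i j eq) (<⇒≢ᶠ i<j)

module _ {p} {P : ℕ → Set p} (P? : Decidable P) where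

  Least : ℕ → ℕ → Set p
  Least k d = d ≤ k × P d × (∀ j → j < d → ¬ P j)

  least : ∀ k → P k → ∃[ d ] Least k d
  least = <-rec (λ k → P k → ∃[ d ] Least k d) search
    where
    search : ∀ k → (∀ {j} → j < k → P j → ∃[ d ] Least j d) → P k → ∃[ d ] Least k d
    search k rec Pk with anyUpTo? P? k
    ... | no none = k , ≤-refl , Pk , λ j j<k Pj → none (j , j<k , Pj)
    ... | yes (j , j<k , Pj) with rec j<k Pj
    ...   | d , d≤j , Pd , minimal = d , ≤-trans d≤j (<⇒≤ j<k) , Pd , minimal

module GraphLemmas {n} (G : Graph n) where
  open Graph G using (adj; irrefl) renaming (sym to adj-sym)
  open import Data.List.Membership.DecPropositional (_≟_ {n}) using () renaming (_∈?_ to _∈ₗ?_)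

  Adj-sym : ∀ {u v} → Adj G u v → Adj G v u
  Adj-sym {u} {v} u~v = trans (adj-sym v u) u~v

  Adj-irrefl : ∀ {v} → ¬ Adj G v v
  Adj-irrefl {v} v~v = contradiction (trans (sym v~v) (irrefl v)) λ ()

  Adj? : ∀ u v → Dec (Adj G u v)
  Adj? u v = adj u v Bool.≟ true

  Walk? : ∀ k u v → Dec (Walk G u v k)
  Walk? zero u v with u ≟ v
  ... | yes refl = yes (here u)
  ... | no u≢v = no λ { (here _) → u≢v refl }
  Walk? (suc k) u v with any? (λ w → Adj? u w ×-dec Walk? k w v)
  ... | yes (w , u~w , walk) = yes (step u~w walk)
  ... | no none = no λ { (step u~w walk) → none (_ , u~w , walk) }

  shortest : ∀ {u v k} → Walk G u v k → ∃[ d ] (d ≤ k × Dist G u v d)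
  shortest {u} {v} {k} = least (λ j → Walk? j u v) k

  Dist-tail : ∀ {h q u t} → Adj G h q → Walk G q u t → Dist G h u (suc t) → Dist G q u t
  Dist-tail h~q walk (_ , minimal) = walk , λ k k<t walk′ → minimal (suc k) (s≤s k<t) (step h~q walk′)

  HasCycleIn-mono : ∀ {S T} → S ⊆ T → HasCycleIn G S → HasCycleIn G T
  HasCycleIn-mono S⊆T (x , xs , len , xs! , x∷xs⊆S , path , closes) =
    x , xs , len , xs! , All.map S⊆T x∷xs⊆S , path , closes

  Path-prefixTo : ∀ {z} x ys (z∈ys : z ∈ₗ ys) → Path G (x ∷ ys) → Path G (x ∷ prefixTo ys z∈ys)
  Path-prefixTo x (y ∷ ys) (here _) (x~y , _) = x~y , _
  Path-prefixTo x (y ∷ ys) (there z∈ys) (x~y , path) = x~y , Path-prefixTo y ys z∈ys path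

  Closes-prefixTo : ∀ {x z} w ys (z∈ys : z ∈ₗ ys) → Adj G z x → Closes G x (w ∷ prefixTo ys z∈ys)
  Closes-prefixTo w (y ∷ ys) (here refl) z~x = z~x
  Closes-prefixTo w (y ∷ ys) (there z∈ys) z~x = Closes-prefixTo y ys z∈ys z~x

  -- δ(G[S]) ≥ 2, in the form used to extend paths: x has a neighbour in S other than any given y.
  MinDegree₂ : Subset n → Set
  MinDegree₂ S = ∀ {x} → x ∈ S → ∀ y → ∃[ z ] (z ∈ S × Adj G x z × z ≢ y)

  module _ {S : Subset n} (minDegree : MinDegree₂ S) where

    private
      -- For a one-vertex path any value will do: a neighbour of x is never x.
      previous : Fin n → List (Fin n) → Fin n
      previous x [] = x
      previous x (r ∷ _) = r

      -- x ∷ rest is a path in G[S], newest vertex first; as a path has at most n vertices,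
      -- k bounds the number of extensions still possible.
      grow : ∀ k x rest → n ≤ k + length (x ∷ rest) → Unique (x ∷ rest) → All (_∈ S) (x ∷ rest) →
             Path G (x ∷ rest) → HasCycleIn G S
      extend : ∀ k {x z} rest → n ≤ k + length (x ∷ rest) → z ∉ₗ x ∷ rest → Unique (x ∷ rest) →
               All (_∈ S) (z ∷ x ∷ rest) → Path G (z ∷ x ∷ rest) → HasCycleIn G S

      grow k x rest bound x∷rest! x∷rest⊆S path with minDegree (All.head x∷rest⊆S) (previous x rest)
      ... | z , z∈S , x~z , z≢previous with z ∈ₗ? (x ∷ rest)
      ...   | yes (Any.here z≡x) = contradiction (subst (Adj G x) z≡x x~z) Adj-irrefl
      ...   | yes (there z∈rest) = close rest z∈rest z≢previous x∷rest! x∷rest⊆S path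
        where
        close : ∀ rest → z ∈ₗ rest → z ≢ previous x rest → Unique (x ∷ rest) → All (_∈ S) (x ∷ rest) →
                Path G (x ∷ rest) → HasCycleIn G S
        close (r ∷ rest′) (here z≡r) z≢r _ _ _ = contradiction z≡r z≢r
        close (r ∷ rest′) (there z∈rest′) _ (x∉ ∷ r∷rest′!) (x∈S ∷ r∷rest′⊆S) path =
          x , prefixTo (r ∷ rest′) (there z∈rest′) , s≤s (1≤length-prefixTo rest′ z∈rest′) ,
          All-prefixTo (r ∷ rest′) (there z∈rest′) x∉ ∷ Unique-prefixTo (r ∷ rest′) (there z∈rest′) r∷rest′! ,
          x∈S ∷ All-prefixTo (r ∷ rest′) (there z∈rest′) r∷rest′⊆S ,
          Path-prefixTo x (r ∷ rest′) (there z∈rest′) path ,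
          Closes-prefixTo x (r ∷ rest′) (there z∈rest′) (Adj-sym x~z)
      ...   | no z∉ = extend k rest bound z∉ x∷rest! (z∈S ∷ x∷rest⊆S) (Adj-sym x~z , path)

      extend zero {x} {z} rest bound z∉ x∷rest! _ _ =
        contradiction (Unique⇒length≤ (¬Any⇒All¬ (x ∷ rest) z∉ ∷ x∷rest!)) (<⇒≱ (s≤s bound))
      extend (suc k) {x} {z} rest bound z∉ x∷rest! z∷x∷rest⊆S path =
        grow k z (x ∷ rest) (≤-trans bound (≤-reflexive (sym (+-suc k _))))
          (¬Any⇒All¬ (x ∷ rest) z∉ ∷ x∷rest!) z∷x∷rest⊆S path

    minDegree₂⇒cycle : Nonempty S → HasCycleIn G S
    minDegree₂⇒cycle (x , x∈S) = grow n x [] (m≤m+n n 1) ([] ∷ []) (x∈S ∷ []) _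

  TSSeq-independentʳ : ∀ {I J m} → TSSeq G I J m → Independent G J
  TSSeq-independentʳ (done J-ind) = J-ind
  TSSeq-independentʳ (move _ _ rest) = TSSeq-independentʳ rest

  infixr 5 _++ₜₛ_
  _++ₜₛ_ : ∀ {I J K m m′} → TSSeq G I J m → TSSeq G J K m′ → TSSeq G I K (m + m′)
  done _ ++ₜₛ seq′ = seq′
  move I-ind mv seq ++ₜₛ seq′ = move I-ind mv (seq ++ₜₛ seq′)

  module _ {K : Subset n} {a b : Fin n} (a∈K : a ∈ K) (b∉K : b ∉ K) where

    slide-move : Adj G a b → Move G K (slide K a b)
    slide-move a~b = a , b , a~b , (λ x → mk⇔ left (λ { refl → a∈K , a∉slide (x∈p∧y∉p⇒x≢y a∈K b∉K) })) ,
                                    (λ x → mk⇔ right (λ { refl → b∈slide , b∉K }))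
      where
      left : ∀ {x} → x ∈ K × x ∉ slide K a b → x ≡ a
      left {x} (x∈K , x∉slide) with x ≟ a
      ... | yes x≡a = x≡a
      ... | no x≢a = contradiction (∈-slide⁺ x∈K x≢a) x∉slide
      right : ∀ {x} → x ∈ slide K a b × x ∉ K → x ≡ b
      right (x∈slide , x∉K) with ∈-slide⁻ x∈slide
      ... | inj₁ x≡b = x≡b
      ... | inj₂ (x∈K , _) = contradiction x∈K x∉K

    slide-independent : Independent G K → (∀ z → z ∈ K → Adj G b z → z ≡ a) → Independent G (slide K a b)
    slide-independent K-ind only-a u v u∈ v∈ with ∈-slide⁻ u∈ | ∈-slide⁻ v∈
    ... | inj₁ refl | inj₁ refl = Adj-irrefl
    ... | inj₁ refl | inj₂ (v∈K , v≢a) = v≢a ∘ only-a v v∈K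
    ... | inj₂ (u∈K , u≢a) | inj₁ refl = u≢a ∘ only-a u u∈K ∘ Adj-sym
    ... | inj₂ (u∈K , _) | inj₂ (v∈K , _) = K-ind u v u∈K v∈K

    slide-step : Independent G K → Adj G a b → (∀ z → z ∈ K → Adj G b z → z ≡ a) → TSSeq G K (slide K a b) 1
    slide-step K-ind a~b only-a = move K-ind (slide-move a~b) (done (slide-independent K-ind only-a))

2+m≤2*[1+t] : ∀ {m} t → m ≤ 2 * t → 2 + m ≤ 2 * suc t
2+m≤2*[1+t] t m≤2t = ≤-trans (+-monoʳ-≤ 2 m≤2t) (≤-reflexive (sym (*-suc 2 t)))

m₁+m₂≤2*k*D : ∀ {m₁ m₂ k′ k} D → m₁ ≤ 2 * D → m₂ ≤ 2 * k′ * D → k′ < k → m₁ + m₂ ≤ 2 * k * D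
m₁+m₂≤2*k*D {m₁} {m₂} {k′} {k} D m₁≤2D m₂≤2k′D k′<k = begin
  m₁ + m₂                ≤⟨ +-mono-≤ m₁≤2D m₂≤2k′D ⟩
  2 * D + 2 * k′ * D     ≡⟨ *-distribʳ-+ D 2 (2 * k′) ⟨
  (2 + 2 * k′) * D       ≡⟨ cong (_* D) (*-suc 2 k′) ⟨
  2 * suc k′ * D         ≤⟨ *-monoˡ-≤ D (*-monoʳ-≤ 2 k′<k) ⟩
  2 * k * D              ∎
  where open ≤-Reasoning

module ClawFreeLemmas {n} (G : Graph n) (claw-free : ClawFree G) where
  open GraphLemmas G

  clawFree⇒≡ : ∀ {c a b d} → Adj G c a → Adj G c b → Adj G c d →
               ¬ Adj G a b → ¬ Adj G a d → ¬ Adj G b d → a ≢ b → a ≢ d → b ≡ d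
  clawFree⇒≡ {c} {a} {b} {d} c~a c~b c~d a≁b a≁d b≁d a≢b a≢d with b ≟ d
  ... | yes b≡d = b≡d
  ... | no b≢d = contradiction (c , a , b , d , c~a , c~b , c~d , a≢b , a≢d , b≢d , a≁b , a≁d , b≁d) claw-free

  NoNeighbourIn : Subset n → Fin n → Set
  NoNeighbourIn I h = ∀ z → z ∈ I → ¬ Adj G h z

  module _ {I : Subset n} {h : Fin n} (I-ind : Independent G I) (h∉I : h ∉ I) (h-free : NoNeighbourIn I h) where

    extend-slide : ∀ {u q m} → TSSeq G I (slide I u q) m → q ∉ I → Adj G q h → TSSeq G I (slide I u h) (m + 1)
    extend-slide {u} {q} {m} seq q∉I q~h =
      subst (λ J → TSSeq G I J (m + 1)) (slide-trans q∉I)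
        (seq ++ₜₛ slide-step b∈slide h∉K (TSSeq-independentʳ seq) q~h only-q)
      where
      h∉K : h ∉ slide I u q
      h∉K h∈K with ∈-slide⁻ h∈K
      ... | inj₁ refl = Adj-irrefl q~h
      ... | inj₂ (h∈I , _) = h∉I h∈I
      only-q : ∀ z → z ∈ slide I u q → Adj G h z → z ≡ q
      only-q z z∈K h~z with ∈-slide⁻ z∈K
      ... | inj₁ z≡q = z≡q
      ... | inj₂ (z∈I , _) = contradiction h~z (h-free z z∈I)

    hop : ∀ {q y} → Adj G h q → y ∈ I → Adj G q y → TSSeq G I (slide I y h) 2
    hop {q} {y} h~q y∈I q~y = extend-slide (slide-step y∈I q∉I I-ind (Adj-sym q~y) only-y) q∉I (Adj-sym h~q)
      where
      q∉I : q ∉ I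
      q∉I q∈I = h-free q q∈I h~q
      only-y : ∀ z → z ∈ I → Adj G q z → z ≡ y
      only-y z z∈I q~z = sym (clawFree⇒≡ (Adj-sym h~q) q~y q~z (h-free y y∈I) (h-free z z∈I) (I-ind y z y∈I z∈I)
                                        (x∈p∧y∉p⇒x≢y y∈I h∉I ∘ sym) (x∈p∧y∉p⇒x≢y z∈I h∉I ∘ sym))

    vacated-no-neighbour : ∀ {y} → y ∈ I → NoNeighbourIn (slide I y h) y
    vacated-no-neighbour {y} y∈I z z∈ y~z with ∈-slide⁻ z∈
    ... | inj₁ refl = h-free y y∈I (Adj-sym y~z)
    ... | inj₂ (z∈I , _) = I-ind y z y∈I z∈I y~z

  claw-shortcut : ∀ {h q₁ q₂ u y t} → Adj G h q₁ → Adj G q₁ q₂ → Walk G q₂ u t →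
                  (∀ k → k < 2 + t → ¬ Walk G h u k) → Adj G q₁ y → ¬ Adj G h y → h ≢ y →
                  ∃[ L ] (L ≤ suc t × Walk G y u L)
  claw-shortcut {q₂ = q₂} {y = y} {t} h~q₁ q₁~q₂ walk minimal q₁~y h≁y h≢y with y ≟ q₂ | Adj? y q₂
  ... | yes refl | _ = t , n≤1+n t , walk
  ... | no _ | yes y~q₂ = suc t , ≤-refl , step y~q₂ walk
  ... | no y≢q₂ | no y≁q₂ =
    contradiction (clawFree⇒≡ (Adj-sym h~q₁) q₁~q₂ q₁~y h≁q₂ h≁y (y≁q₂ ∘ Adj-sym) h≢q₂ h≢y) (y≢q₂ ∘ sym)
    where
    h≁q₂ : ¬ Adj G _ q₂
    h≁q₂ h~q₂ = minimal (suc t) ≤-refl (step h~q₂ walk)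
    h≢q₂ : _ ≢ q₂
    h≢q₂ refl = minimal t (n≤1+n _) walk

  TokenTransport : ℕ → Set
  TokenTransport t = ∀ {I h u} → Independent G I → h ∉ I → NoNeighbourIn I h → u ∈ I → Dist G h u t →
                     ∃[ m ] (m ≤ 2 * t × TSSeq G I (slide I u h) m)

  transport : ∀ t → TokenTransport t
  transport = <-rec TokenTransport go
    where
    go : ∀ t → (∀ {t′} → t′ < t → TokenTransport t′) → TokenTransport t
    go zero _ _ h∉I _ u∈I (here _ , _) = contradiction u∈I h∉I
    go (suc zero) _ _ _ h-free u∈I (step h~u (here _) , _) = contradiction h~u (h-free _ u∈I)
    go (suc (suc t)) rec {I} {h} {u} I-ind h∉I h-free u∈I dist@(step {w = q₁} h~q₁ (step q₁~q₂ walk) , minimal)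
      with any? (λ z → z ∈? I ×-dec Adj? q₁ z)
    ... | no no-neighbour =
      let m , m≤2t , seq = rec ≤-refl I-ind q₁∉I q₁-free u∈I (Dist-tail h~q₁ (step q₁~q₂ walk) dist)
      in m + 1 , ≤-trans (≤-reflexive (+-comm m 1)) (≤-trans (n≤1+n _) (2+m≤2*[1+t] (suc t) m≤2t)) ,
         extend-slide I-ind h∉I h-free seq q₁∉I (Adj-sym h~q₁)
      where
      q₁∉I : q₁ ∉ I
      q₁∉I q₁∈I = h-free q₁ q₁∈I h~q₁
      q₁-free : NoNeighbourIn I q₁
      q₁-free z z∈I q₁~z = no-neighbour (z , z∈I , q₁~z)
    ... | yes (y , y∈I , q₁~y) with y ≟ u
    ...   | yes refl = 2 , 2+m≤2*[1+t] (suc t) z≤n , hop I-ind h∉I h-free h~q₁ y∈I q₁~y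
    ...   | no y≢u =
      let L , L≤1+t , y-walk = claw-shortcut h~q₁ q₁~q₂ walk minimal q₁~y (h-free y y∈I) h≢y
          d , d≤L , y-dist = shortest y-walk
          d≤1+t = ≤-trans d≤L L≤1+t
          m , m≤2d , seq = rec (s≤s d≤1+t) (TSSeq-independentʳ hop-seq) (a∉slide (h≢y ∘ sym))
                             (vacated-no-neighbour I-ind h∉I h-free y∈I) (∈-slide⁺ u∈I (y≢u ∘ sym)) y-dist
      in 2 + m , 2+m≤2*[1+t] (suc t) (≤-trans m≤2d (*-monoʳ-≤ 2 d≤1+t)) ,
         hop-seq ++ₜₛ subst (λ J → TSSeq G (slide I y h) J m) (slide-relay y∈I (y≢u ∘ sym) h≢u h≢y) seq
      where
      hop-seq = hop I-ind h∉I h-free h~q₁ y∈I q₁~y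
      h≢u = x∈p∧y∉p⇒x≢y u∈I h∉I ∘ sym
      h≢y = x∈p∧y∉p⇒x≢y y∈I h∉I ∘ sym

module Reconfiguration {n} (G : Graph n) (claw-free : ClawFree G) (connected : Connected G)
                       (D : ℕ) (diameter : IsDiameter G D) {J : Subset n} (J-ind : Independent G J) where
  open GraphLemmas G
  open ClawFreeLemmas G claw-free

  dist≤D : ∀ u v → ∃[ d ] (d ≤ D × Dist G u v d)
  dist≤D u v with shortest (proj₂ (connected u v))
  ... | d , _ , dist = d , proj₁ diameter u v d dist , dist

  module _ {I : Subset n} (I-ind : Independent G I) where

    Exchange : Set
    Exchange = ∃[ u ] ∃[ v ] (u ∈ I × u ∉ J × v ∈ J × v ∉ I × ∃[ m ] (m ≤ 2 * D × TSSeq G I (slide I u v) m))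

    CrossEdge : Fin n → Fin n → Set
    CrossEdge u v = u ∈ I ─ J × v ∈ J ─ I × Adj G u v

    CrossEdge? : ∀ u v → Dec (CrossEdge u v)
    CrossEdge? u v = u ∈? I ─ J ×-dec v ∈? J ─ I ×-dec Adj? u v

    I-neighbour⇒CrossEdge : ∀ {u v} → u ∈ I → v ∈ J ─ I → Adj G v u → CrossEdge u v
    I-neighbour⇒CrossEdge u∈I v∈J─I v~u =
      x∈p∧x∉q⇒x∈p─q u∈I (λ u∈J → J-ind _ _ (p─q⊆p J I v∈J─I) u∈J v~u) , v∈J─I , Adj-sym v~u

    few-neighbours⇒exchange : Nonempty (I ─ J) → ∀ {v} → v ∈ J ─ I → inDegree CrossEdge? v ≤ 1 → Exchange
    few-neighbours⇒exchange (u₀ , u₀∈I─J) {v} v∈J─I in≤1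
      with x∈p─q⁻ I J u₀∈I─J | x∈p─q⁻ J I v∈J─I | any? (λ z → z ∈? I ×-dec Adj? v z)
    ... | u₀∈I , u₀∉J | v∈J , v∉I | no no-neighbour =
      let d , d≤D , dist = dist≤D v u₀
          m , m≤2d , seq = transport d I-ind v∉I (λ z z∈I v~z → no-neighbour (z , z∈I , v~z)) u₀∈I dist
      in u₀ , v , u₀∈I , u₀∉J , v∈J , v∉I , m , ≤-trans m≤2d (*-monoʳ-≤ 2 d≤D) , seq
    ... | _ | v∈J , v∉I | yes (u , u∈I , v~u) =
      u , v , u∈I , x∈p─q⇒x∉q (proj₁ (I-neighbour⇒CrossEdge u∈I v∈J─I v~u)) , v∈J , v∉I ,
      1 , 1≤2D , slide-step u∈I v∉I I-ind (Adj-sym v~u) only-u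
      where
      in-column : ∀ {z} → z ∈ I → Adj G v z → z ∈ subset (λ z → CrossEdge? z v)
      in-column z∈I v~z = ∈-subset⁺ (λ z → CrossEdge? z v) (I-neighbour⇒CrossEdge z∈I v∈J─I v~z)
      only-u : ∀ z → z ∈ I → Adj G v z → z ≡ u
      only-u z z∈I v~z = ∣p∣≤1⇒≡ in≤1 (in-column z∈I v~z) (in-column u∈I v~u)
      1≤2D : 1 ≤ 2 * D
      1≤2D with dist≤D u v
      ... | zero , _ , here _ , _ = contradiction u∈I v∉I
      ... | suc d , 1+d≤D , _ = ≤-trans (s≤s z≤n) (≤-trans 1+d≤D (m≤n*m D 2))

    outDegree≤2 : ∀ u → outDegree CrossEdge? u ≤ 2
    outDegree≤2 u with 3 ≤? outDegree CrossEdge? u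
    ... | no 3≰out = ≤-pred (≰⇒> 3≰out)
    ... | yes 3≤out =
      let a , b , c , a∈ , b∈ , c∈ , a≢b , a≢c , b≢c = 3≤∣p∣⇒distinct 3≤out
          _ , a∈J─I , u~a = ∈-subset⁻ (CrossEdge? u) a∈
          _ , b∈J─I , u~b = ∈-subset⁻ (CrossEdge? u) b∈
          _ , c∈J─I , u~c = ∈-subset⁻ (CrossEdge? u) c∈
          J-ind′ : ∀ {x y} → x ∈ J ─ I → y ∈ J ─ I → ¬ Adj G x y
          J-ind′ x∈ y∈ = J-ind _ _ (p─q⊆p J I x∈) (p─q⊆p J I y∈)
      in contradiction (u , a , b , c , u~a , u~b , u~c , a≢b , a≢c , b≢c ,
                        J-ind′ a∈J─I b∈J─I , J-ind′ a∈J─I c∈J─I , J-ind′ b∈J─I c∈J─I) claw-free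

    many-neighbours⇒cycle : ∣ I ∣ ≡ ∣ J ∣ → Nonempty (I ─ J) → (∀ v → v ∈ J ─ I → 2 ≤ inDegree CrossEdge? v) →
                            HasCycleIn G (SymDiff I J)
    many-neighbours⇒cycle ∣I∣≡∣J∣ (u₀ , u₀∈I─J) 2≤in = minDegree₂⇒cycle minDegree (u₀ , x∈p∪q⁺ (inj₁ u₀∈I─J))
      where
      2≤out : ∀ u → u ∈ I ─ J → 2 ≤ outDegree CrossEdge? u
      2≤out = c≤inDegree⇒c≤outDegree CrossEdge? (I ─ J) (J ─ I) 2 (∣p∣≡∣q∣⇒∣p─q∣≡∣q─p∣ I J ∣I∣≡∣J∣) proj₁
                (λ u _ → outDegree≤2 u) 2≤in
      minDegree : MinDegree₂ (SymDiff I J)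
      minDegree {x} x∈ y with x∈p∪q⁻ (I ─ J) (J ─ I) x∈
      ... | inj₁ x∈I─J with 2≤∣p∣⇒other (2≤out x x∈I─J) y
      ...   | z , z∈ , z≢y with ∈-subset⁻ (CrossEdge? x) z∈
      ...     | _ , z∈J─I , x~z = z , x∈p∪q⁺ (inj₂ z∈J─I) , x~z , z≢y
      minDegree {x} x∈ y | inj₂ x∈J─I with 2≤∣p∣⇒other (2≤in x x∈J─I) y
      ...   | z , z∈ , z≢y with ∈-subset⁻ (λ z → CrossEdge? z x) z∈
      ...     | z∈I─J , _ , z~x = z , x∈p∪q⁺ (inj₁ z∈I─J) , Adj-sym z~x , z≢y

    exchange : ∣ I ∣ ≡ ∣ J ∣ → ¬ HasCycleIn G (SymDiff I J) → Nonempty (I ─ J) → Exchange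
    exchange ∣I∣≡∣J∣ acyclic I─J≠∅ with any? (λ v → v ∈? J ─ I ×-dec inDegree CrossEdge? v ≤? 1)
    ... | yes (v , v∈J─I , in≤1) = few-neighbours⇒exchange I─J≠∅ v∈J─I in≤1
    ... | no none = contradiction (many-neighbours⇒cycle ∣I∣≡∣J∣ I─J≠∅ 2≤in) acyclic
      where
      2≤in : ∀ v → v ∈ J ─ I → 2 ≤ inDegree CrossEdge? v
      2≤in v v∈J─I = ≰⇒> (λ in≤1 → none (v , v∈J─I , in≤1))

  Reconfigurable : ℕ → Set
  Reconfigurable k = ∀ {I} → ∣ I ─ J ∣ ≡ k → Independent G I → ∣ I ∣ ≡ ∣ J ∣ → ¬ HasCycleIn G (SymDiff I J) →
                     ∃[ m ] (m ≤ 2 * k * D × TSSeq G I J m)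

  reconfigure : ∀ k → Reconfigurable k
  reconfigure = <-rec Reconfigurable go
    where
    go : ∀ k → (∀ {k′} → k′ < k → Reconfigurable k′) → Reconfigurable k
    go _ rec {I} refl I-ind ∣I∣≡∣J∣ acyclic with nonempty? (I ─ J)
    ... | no I─J=∅ = 0 , z≤n , subst (λ K → TSSeq G I K 0) (Empty[p─q]⇒p≡q I─J=∅ ∣I∣≡∣J∣) (done I-ind)
    ... | yes I─J≠∅ =
      let u , v , u∈I , u∉J , v∈J , v∉I , m₁ , m₁≤2D , seq₁ = exchange I-ind ∣I∣≡∣J∣ acyclic I─J≠∅
          m₂ , m₂≤ , seq₂ = rec (p⊂q⇒∣p∣<∣q∣ (slide-─⊂ u∈I u∉J v∈J v∉I)) refl (TSSeq-independentʳ seq₁)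
                              (trans (∣slide∣≡∣K∣ u∈I v∉I) ∣I∣≡∣J∣)
                              (acyclic ∘ HasCycleIn-mono (slide-SymDiff⊆ u∈I u∉J v∈J v∉I))
      in m₁ + m₂ , m₁+m₂≤2*k*D D m₁≤2D m₂≤ (p⊂q⇒∣p∣<∣q∣ (slide-─⊂ u∈I u∉J v∈J v∉I)) , seq₁ ++ₜₛ seq₂

lemma17 : (n : ℕ) (G : Graph n) → Connected G → ClawFree G →
          (D : ℕ) → IsDiameter G D →
          (I J : Subset n) → Independent G I → Independent G J →
          ∣ I ∣ ≡ ∣ J ∣ → ¬ HasCycleIn G (SymDiff I J) →
          ∃[ m ] (m ≤ 2 * ∣ I ─ J ∣ * D × TSSeq G I J m)
lemma17 n G connected claw-free D diameter I J I-ind J-ind ∣I∣≡∣J∣ acyclic =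
  Reconfiguration.reconfigure G claw-free connected D diameter J-ind _ refl I-ind ∣I∣≡∣J∣ acyclic
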